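{- Let $G$ be a finite simple graph and let $e$ be an internal edge of $G$ that is not contained in any cycle of $G$. Then $$T\chi^o_G(q)=T\chi^o_{G\odot e}(q)+(1+q)\left(T\chi^o_{G\setminus e}(q)-T\chi^o_{(G\odot e)\setminus\ell_e}(q)\right).$$
   Context: An edge $e=\{u,v\}$ is internal if $\deg(u)\ge2$ and $\deg(v)\ge2$. $G\setminus e$ is $G$ with edge $e$ deleted. $G/e$ (contraction) deletes $u,v,e$, adds a new vertex $v_e$, and replaces each edge $\{u,w\}$ or $\{v,w\}$ by $\{v_e,w\}$. $G\odot e$ (near-contraction) is obtained from $G/e$ by adding a new vertex $v'$ and the single edge $\ell_e=\{v',v_e\}$; $(G\odot e)\setminus\ell_e$ is that graph with $\ell_e$ deleted. An orientation $\gamma$ directs each edge; it is acyclic if there is no directed cycle. For a proper coloring $\kappa:V\to\mathbb{Z}_{>0}$, $\mathrm{asc}^\gamma(\kappa)$ is the number of edges oriented $a\to b$ with $\kappa(a)<\kappa(b)$; $\chi^\gamma_G(x;q)=\sum_\kappa q^{\mathrm{asc}^\gamma(\kappa)}x^\kappa$ with $x^\kappa=\prod_j x_j^{\#\kappa^{ -1}(j)}$; $T\chi^o_G(q)=\sum_\gamma\chi^\gamma_G(x;q)$ over all acyclic orientations $\gamma$ of $G$. -}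

module Defs where

open import Data.Nat using (ℕ; zero; suc; _≤_; _<_)
open import Data.Nat.Properties using (_<?_)
open import Data.Integer using (ℤ; +_; _+_)
open import Data.Fin using (Fin; zero; suc; toℕ; inject₁; fromℕ)
open import Data.Fin.Properties using (_≟_)
import Data.Fin.Properties as FinP
open import Data.List using (List; []; _∷_; [_]; length; filter; map; concatMap; removeAt; lookup; allFin; _++_)
open import Data.List.Relation.Unary.All using (All)
import Data.List.Relation.Unary.All as All
open import Data.List.Relation.Unary.AllPairs using (AllPairs)
open import Data.List.Membership.Propositional using (_∈_)
open import Data.Vec using (Vec; []; _∷_)
import Data.Vec as Vec
open import Data.Bool using (Bool; true; false; if_then_else_)
open import Data.Product using (Σ; ∃; _×_; _,_; proj₁; proj₂; swap)
open import Data.Sum using (_⊎_)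
open import Function.Definitions using (Injective)
open import Relation.Nullary using (¬_; Dec; yes; no; does)
open import Relation.Nullary.Decidable using (_×-dec_; _⊎-dec_; ¬?)
open import Relation.Binary.PropositionalEquality using (_≡_; _≢_)
open import Relation.Binary.Construct.Closure.Transitive using (TransClosure)

-- An edge (a , b) stands for the unordered edge {a , b}.
-- (A general list may contain loops / repeated edges; simplicity is a
-- separate predicate, imposed on G in the theorem.)

record Graph (n : ℕ) : Set where
  constructor mkGraph
  field edges : List (Fin n × Fin n)
open Graph public

SameEdge : ∀ {n} → (Fin n × Fin n) → (Fin n × Fin n) → Set
SameEdge p q = (p ≡ q) ⊎ (p ≡ swap q)

IsSimple : ∀ {n} → Graph n → Set
IsSimple G = All (λ p → proj₁ p ≢ proj₂ p) (edges G)
           × AllPairs (λ p q → ¬ SameEdge p q) (edges G)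

Edge : ∀ {n} → Graph n → Set
Edge G = Fin (length (edges G))

endpoints : ∀ {n} (G : Graph n) → Edge G → Fin n × Fin n
endpoints G e = lookup (edges G) e

deg : ∀ {n} → Graph n → Fin n → ℕ
deg G w = length (filter (λ p → (proj₁ p ≟ w) ⊎-dec (proj₂ p ≟ w)) (edges G))

Internal : ∀ {n} (G : Graph n) → Edge G → Set
Internal G e = (2 ≤ deg G (proj₁ (endpoints G e))) × (2 ≤ deg G (proj₂ (endpoints G e)))

Adj : ∀ {n} → Graph n → Fin n → Fin n → Set
Adj G a b = ((a , b) ∈ edges G) ⊎ ((b , a) ∈ edges G)

record Cycle {n : ℕ} (G : Graph n) : Set where
  field
    k     : ℕ
    len≥3 : 2 ≤ k
    c     : Fin (suc k) → Fin n
    inj   : Injective _≡_ _≡_ c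
    step  : (i : Fin k) → Adj G (c (inject₁ i)) (c (suc i))
    close : Adj G (c (fromℕ k)) (c zero)
open Cycle public

CycleUses : ∀ {n} {G : Graph n} → Cycle G → Fin n → Fin n → Set
CycleUses C a b =
  (Σ (Fin (k C)) λ i → SameEdge (c C (inject₁ i) , c C (suc i)) (a , b))
  ⊎ SameEdge (c C (fromℕ (k C)) , c C zero) (a , b)

InNoCycle : ∀ {n} (G : Graph n) → Edge G → Set
InNoCycle G e = (C : Cycle G) → ¬ CycleUses C (proj₁ (endpoints G e)) (proj₂ (endpoints G e))

-- For e = {u , v} (u = proj₁, v = proj₂ of its
-- stored pair) we keep the vertex set Fin n: in G ⊙ e the vertex u plays
-- the role of the new vertex v_e and v plays the role of the new leaf v'.

deleteEdge : ∀ {n} (G : Graph n) → Edge G → Graph n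
deleteEdge G e = mkGraph (removeAt (edges G) e)

private
  ren : ∀ {n} → Fin n → Fin n → Fin n → Fin n
  ren u v w = if does (w ≟ v) then u else w

-- (G ⊙ e) ∖ ℓ_e  =  G / e  together with the isolated vertex v'
nearContractDel : ∀ {n} (G : Graph n) → Edge G → Graph n
nearContractDel G e =
  mkGraph (map (λ p → ren u v (proj₁ p) , ren u v (proj₂ p)) (removeAt (edges G) e))
  where
  u = proj₁ (endpoints G e)
  v = proj₂ (endpoints G e)

-- G ⊙ e : add the leaf edge ℓ_e = {v_e , v'} = {u , v}
nearContract : ∀ {n} (G : Graph n) → Edge G → Graph n
nearContract G e =
  mkGraph (edges (nearContractDel G e) ++ [ endpoints G e ])

-- Orientations: one Bool per edge; true orients (a , b) as a → b,
-- false as b → a.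

Orientation : ∀ {n} → Graph n → Set
Orientation G = Vec Bool (length (edges G))

arcs : ∀ {n} (G : Graph n) → Orientation G → List (Fin n × Fin n)
arcs G γ = go (edges G) γ
  where
  go : ∀ {n} (es : List (Fin n × Fin n)) → Vec Bool (length es) → List (Fin n × Fin n)
  go [] [] = []
  go ((a , b) ∷ es) (true ∷ γ)  = (a , b) ∷ go es γ
  go ((a , b) ∷ es) (false ∷ γ) = (b , a) ∷ go es γ

Arc : ∀ {n} (G : Graph n) → Orientation G → Fin n → Fin n → Set
Arc G γ a b = (a , b) ∈ arcs G γ

Acyclic : ∀ {n} (G : Graph n) → Orientation G → Set
Acyclic G γ = ∀ a → ¬ TransClosure (Arc G γ) a a

-- Colourings.  The coefficient of x^α in a symmetric function of
-- x₁, x₂, ... where α is supported on {1..m} is recorded by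
-- α : Vec ℕ m; colour j+1 is represented by j : Fin m.

allVecs : ∀ {A : Set} → List A → (n : ℕ) → List (Vec A n)
allVecs xs zero    = [ [] ]
allVecs xs (suc n) = concatMap (λ x → map (x ∷_) (allVecs xs n)) xs

Colouring : ℕ → ℕ → Set
Colouring n m = Vec (Fin m) n

Proper : ∀ {n m} → Graph n → Colouring n m → Set
Proper G κ = All (λ p → Vec.lookup κ (proj₁ p) ≢ Vec.lookup κ (proj₂ p)) (edges G)

proper? : ∀ {n m} (G : Graph n) (κ : Colouring n m) → Dec (Proper G κ)
proper? G κ = All.all? (λ p → ¬? (Vec.lookup κ (proj₁ p) ≟ Vec.lookup κ (proj₂ p))) (edges G)

mult : ∀ {n m} → Colouring n m → Fin m → ℕ
mult {n} κ j = length (filter (λ w → Vec.lookup κ w ≟ j) (allFin n))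

HasMonomial : ∀ {n m} → Colouring n m → Vec ℕ m → Set
HasMonomial κ α = ∀ j → mult κ j ≡ Vec.lookup α j

hasMonomial? : ∀ {n m} (κ : Colouring n m) (α : Vec ℕ m) → Dec (HasMonomial κ α)
hasMonomial? κ α = FinP.all? (λ j → Data.Nat.Properties._≟_ (mult κ j) (Vec.lookup α j))
  where import Data.Nat.Properties

asc : ∀ {n m} (G : Graph n) → Orientation G → Colouring n m → ℕ
asc G γ κ = length (filter (λ p → toℕ (Vec.lookup κ (proj₁ p)) <? toℕ (Vec.lookup κ (proj₂ p))) (arcs G γ))

-- coefficient of q^k x^α in χ^γ_G(x;q)
chiCoeff : ∀ {n} (G : Graph n) → Orientation G → (m : ℕ) → Vec ℕ m → ℕ → ℕ
chiCoeff {n} G γ m α k =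
  length (filter (λ κ → proper? G κ ×-dec (hasMonomial? κ α ×-dec Data.Nat.Properties._≟_ (asc G γ κ) k))
                 (allVecs (allFin m) n))
  where import Data.Nat.Properties

-- A decision procedure for acyclicity (any one; the count below does
-- not depend on which, since Acyclic G γ is a proposition).
AcyclicDecider : Set
AcyclicDecider = ∀ {n} (G : Graph n) (γ : Orientation G) → Dec (Acyclic G γ)

sumℕ : List ℕ → ℕ
sumℕ [] = 0
sumℕ (x ∷ xs) = x Data.Nat.+ sumℕ xs
  where import Data.Nat

-- coefficient of q^k x^α in Tχ^o_G(q) = Σ_{γ acyclic} χ^γ_G(x;q)
TchiCoeff : AcyclicDecider → ∀ {n} (G : Graph n) → (m : ℕ) → Vec ℕ m → ℕ → ℤ
TchiCoeff acyc? G m α k =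
  + sumℕ (map (λ γ → chiCoeff G γ m α k)
              (filter (acyc? G) (allVecs (true ∷ false ∷ []) (length (edges G)))))

-- coefficients of (1 + q) · f, for f given by its q-coefficients
onePlusQ : (ℕ → ℤ) → ℕ → ℤ
onePlusQ f zero    = f zero
onePlusQ f (suc k) = f (suc k) + f k

module Submission where

-- Write D = G ∖ e, C = (G ⊙ e) ∖ ℓ_e (D with the endpoints u, v of e merged, plus the isolated
-- vertex v) and N = G ⊙ e = C + ℓ_e.  Orientations of G and N are orientations γ of D, carried
-- over to C, plus one bit for e resp. ℓ_e; since e is a bridge, every one of them is acyclic
-- exactly when γ is.  Fix γ and a colouring κ.  If κ u = κ v, then κ is proper on neither G
-- nor N, and it counts the same on C as on D because merging u and v changes no colour.  If
-- κ u ≠ κ v, exactly one orientation of e (and of ℓ_e) is an ascent, so κ contributes (1 + q)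
-- times its D-contribution to G and (1 + q) times its C-contribution to N.  Either way
-- G + (1 + q) C = N + (1 + q) D, and summing over κ and γ gives the theorem.

open import Defs
open import Data.Bool using (Bool; true; false; _∧_; not; if_then_else_)
open import Data.Bool.Properties using (∧-assoc; ∧-zeroʳ)
open import Data.Empty using (⊥; ⊥-elim)
open import Data.Fin using (Fin; zero; suc; toℕ; inject₁; fromℕ)
open import Data.Fin.Properties using (_≟_; toℕ-injective)
open import Data.List using (List; []; _∷_; _++_; length; map; filter; lookup; removeAt; allFin)
open import Data.List.Membership.Propositional using (_∈_)
open import Data.List.Membership.Propositional.Properties using (∈-lookup; ∈-map⁺; ∈-map⁻)
open import Data.List.Relation.Binary.Permutation.Propositional
  using (_↭_; ↭-refl; ↭-reflexive; ↭-sym; ↭-trans; prep; swap; module PermutationReasoning)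
open import Data.List.Relation.Binary.Permutation.Propositional.Properties
  using (∈-resp-↭; All-resp-↭; filter-↭; ↭-length; ∷↭∷ʳ)
open import Data.List.Relation.Unary.All using ([]; _∷_)
import Data.List.Relation.Unary.All as All
open import Data.List.Relation.Unary.All.Properties
  using (¬Any⇒All¬) renaming (map⁺ to All-map⁺; map⁻ to All-map⁻)
open import Data.List.Relation.Unary.Any using (here; there; any?)
open import Data.List.Relation.Unary.AllPairs using (AllPairs; []; _∷_)
open import Data.List.Relation.Unary.Linked using (Linked; []; [-]; _∷_)
import Data.List.Relation.Unary.Linked as Linked
open import Data.List.Relation.Unary.Unique.Propositional using (Unique)
open import Data.Nat using (ℕ; zero; suc; _<_; s≤s; z≤n)
import Data.Nat as ℕ
open import Data.Nat.Properties
  using (+-comm; +-assoc; +-identityʳ; *-identityˡ; *-zeroʳ; *-distribˡ-+; _<?_; <-asym; ≮⇒≥; ≤-antisym)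
  renaming (_≟_ to _≟ℕ_)
open import Data.Product using (∃₂; _×_; _,_; proj₁; proj₂)
import Data.Product as Product
open import Data.Sum using (_⊎_; inj₁; inj₂)
import Data.Sum as Sum
open import Data.Vec using (Vec; []; _∷_)
import Data.Vec as Vec
open import Function using (_∘_)
open import Function.Bundles using (_⇔_; mk⇔; Equivalence)
open import Relation.Binary.Construct.Closure.Transitive
  using (TransClosure; [_]; _∷_; symmetric) renaming (_++_ to _++⁺_)
open import Relation.Binary.Definitions using (DecidableEquality)
open import Relation.Nullary using (Dec; yes; no; does; ¬_; _×-dec_)
open import Relation.Nullary.Decidable using (does-⇔; dec-false)
open import Relation.Unary using (Decidable)
open import Relation.Binary.PropositionalEquality
  using (_≡_; _≢_; refl; sym; trans; cong; cong₂; subst; module ≡-Reasoning)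

-- ℕ arithmetic is opened only inside this block, so that _+_ and _-_ in the theorem are ℤ's.
module _ where
  open import Data.Nat using (_+_; _*_)
  open import Data.Nat.Tactic.RingSolver using (solve-∀)

  indicator : Bool → ℕ
  indicator true  = 1
  indicator false = 0

  sumOver : {A : Set} → List A → (A → ℕ) → ℕ
  sumOver xs f = sumℕ (map f xs)

  module _ {A : Set} where

    sumOver-cong : (xs : List A) {f g : A → ℕ} → (∀ x → f x ≡ g x) → sumOver xs f ≡ sumOver xs g
    sumOver-cong []       f≗g = refl
    sumOver-cong (x ∷ xs) f≗g = cong₂ _+_ (f≗g x) (sumOver-cong xs f≗g)

    sumOver-+ : (xs : List A) (f g : A → ℕ) →
                sumOver xs (λ x → f x + g x) ≡ sumOver xs f + sumOver xs g
    sumOver-+ []       f g = refl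
    sumOver-+ (x ∷ xs) f g = begin
      (f x + g x) + sumOver xs (λ x → f x + g x) ≡⟨ cong ((f x + g x) +_) (sumOver-+ xs f g) ⟩
      (f x + g x) + (sumOver xs f + sumOver xs g) ≡⟨ interchange (f x) (g x) _ _ ⟩
      (f x + sumOver xs f) + (g x + sumOver xs g) ∎
      where
      open ≡-Reasoning
      interchange : ∀ a b c d → (a + b) + (c + d) ≡ (a + c) + (b + d)
      interchange = solve-∀

    sumOver-zero : (xs : List A) → sumOver xs (λ _ → 0) ≡ 0
    sumOver-zero []       = refl
    sumOver-zero (x ∷ xs) = sumOver-zero xs

    sumOver-++ : (xs ys : List A) (f : A → ℕ) → sumOver (xs ++ ys) f ≡ sumOver xs f + sumOver ys f
    sumOver-++ []       ys f = refl
    sumOver-++ (x ∷ xs) ys f = trans (cong (f x +_) (sumOver-++ xs ys f)) (sym (+-assoc (f x) _ _))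

    sumOver-map : {B : Set} (g : B → A) (xs : List B) (f : A → ℕ) →
                  sumOver (map g xs) f ≡ sumOver xs (λ x → f (g x))
    sumOver-map g []       f = refl
    sumOver-map g (x ∷ xs) f = cong (f (g x) +_) (sumOver-map g xs f)

    module _ {P : A → Set} (P? : Decidable P) where

      length-filter-∷ : ∀ x xs →
                        length (filter P? (x ∷ xs)) ≡ indicator (does (P? x)) + length (filter P? xs)
      length-filter-∷ x xs with does (P? x)
      ... | true  = refl
      ... | false = refl

      length-filter : ∀ xs → length (filter P? xs) ≡ sumOver xs (λ x → indicator (does (P? x)))
      length-filter []       = refl
      length-filter (x ∷ xs) = trans (length-filter-∷ x xs) (cong (_ +_) (length-filter xs))

      sumOver-filter : ∀ xs (f : A → ℕ) →
                       sumOver (filter P? xs) f ≡ sumOver xs (λ x → indicator (does (P? x)) * f x)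
      sumOver-filter []       f = refl
      sumOver-filter (x ∷ xs) f with does (P? x)
      ... | true  = cong₂ _+_ (sym (*-identityˡ (f x))) (sumOver-filter xs f)
      ... | false = sumOver-filter xs f

      length-filter-map : (f : A → A) → (∀ x → does (P? (f x)) ≡ does (P? x)) →
                          ∀ xs → length (filter P? (map f xs)) ≡ length (filter P? xs)
      length-filter-map f same []       = refl
      length-filter-map f same (x ∷ xs) = begin
        length (filter P? (f x ∷ map f xs))
          ≡⟨ length-filter-∷ (f x) (map f xs) ⟩
        indicator (does (P? (f x))) + length (filter P? (map f xs))
          ≡⟨ cong₂ (λ b l → indicator b + l) (same x) (length-filter-map f same xs) ⟩
        indicator (does (P? x)) + length (filter P? xs)
          ≡⟨ sym (length-filter-∷ x xs) ⟩
        length (filter P? (x ∷ xs)) ∎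
        where open ≡-Reasoning

  qTimes : (ℕ → ℕ) → ℕ → ℕ
  qTimes f zero    = 0
  qTimes f (suc k) = f k

  onePlusQℕ : (ℕ → ℕ) → ℕ → ℕ
  onePlusQℕ f k = f k + qTimes f k

  onePlusQℕ-cong : {f g : ℕ → ℕ} → (∀ k → f k ≡ g k) → ∀ k → onePlusQℕ f k ≡ onePlusQℕ g k
  onePlusQℕ-cong f≗g zero    = cong (_+ 0) (f≗g zero)
  onePlusQℕ-cong f≗g (suc k) = cong₂ _+_ (f≗g (suc k)) (f≗g k)

  onePlusQℕ-sum : {A : Set} (xs : List A) (F : A → ℕ → ℕ) → ∀ k →
                  onePlusQℕ (λ j → sumOver xs (λ x → F x j)) k ≡ sumOver xs (λ x → onePlusQℕ (F x) k)
  onePlusQℕ-sum xs F k =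
    trans (cong (sumOver xs (λ x → F x k) +_) (qTimes-sum k))
          (sym (sumOver-+ xs (λ x → F x k) (λ x → qTimes (F x) k)))
    where
    qTimes-sum : ∀ k → qTimes (λ j → sumOver xs (λ x → F x j)) k ≡ sumOver xs (λ x → qTimes (F x) k)
    qTimes-sum zero    = sym (sumOver-zero xs)
    qTimes-sum (suc k) = refl

  onePlusQℕ-scale : (a : ℕ) (f : ℕ → ℕ) → ∀ k → onePlusQℕ (λ j → a * f j) k ≡ a * onePlusQℕ f k
  onePlusQℕ-scale a f k =
    trans (cong (a * f k +_) (qTimes-scale k)) (sym (*-distribˡ-+ a (f k) (qTimes f k)))
    where
    qTimes-scale : ∀ k → qTimes (λ j → a * f j) k ≡ a * qTimes f k
    qTimes-scale zero    = sym (*-zeroʳ a)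
    qTimes-scale (suc k) = refl

  -- The theorem's identity g = n + (1 + q) (d - c), rearranged so that no subtraction occurs.
  Balanced : (g c n d : ℕ → ℕ) → Set
  Balanced g c n d = ∀ k → g k + onePlusQℕ c k ≡ n k + onePlusQℕ d k

  Balanced-cong : ∀ {g c n d g′ c′ n′ d′ : ℕ → ℕ} →
                  (∀ k → g k ≡ g′ k) → (∀ k → c k ≡ c′ k) →
                  (∀ k → n k ≡ n′ k) → (∀ k → d k ≡ d′ k) →
                  Balanced g c n d → Balanced g′ c′ n′ d′
  Balanced-cong g≗ c≗ n≗ d≗ bal k =
    trans (sym (cong₂ _+_ (g≗ k) (onePlusQℕ-cong c≗ k)))
          (trans (bal k) (cong₂ _+_ (n≗ k) (onePlusQℕ-cong d≗ k)))

  Balanced-sum : {A : Set} (xs : List A) {G C N D : A → ℕ → ℕ} →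
                 (∀ x → Balanced (G x) (C x) (N x) (D x)) →
                 Balanced (λ k → sumOver xs (λ x → G x k)) (λ k → sumOver xs (λ x → C x k))
                          (λ k → sumOver xs (λ x → N x k)) (λ k → sumOver xs (λ x → D x k))
  Balanced-sum xs {G} {C} {N} {D} bal k = begin
    sumOver xs (λ x → G x k) + onePlusQℕ (λ j → sumOver xs (λ x → C x j)) k
      ≡⟨ cong (_ +_) (onePlusQℕ-sum xs C k) ⟩
    sumOver xs (λ x → G x k) + sumOver xs (λ x → onePlusQℕ (C x) k)
      ≡⟨ sym (sumOver-+ xs _ _) ⟩
    sumOver xs (λ x → G x k + onePlusQℕ (C x) k)
      ≡⟨ sumOver-cong xs (λ x → bal x k) ⟩
    sumOver xs (λ x → N x k + onePlusQℕ (D x) k)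
      ≡⟨ sumOver-+ xs _ _ ⟩
    sumOver xs (λ x → N x k) + sumOver xs (λ x → onePlusQℕ (D x) k)
      ≡⟨ cong (_ +_) (sym (onePlusQℕ-sum xs D k)) ⟩
    sumOver xs (λ x → N x k) + onePlusQℕ (λ j → sumOver xs (λ x → D x j)) k ∎
    where open ≡-Reasoning

  Balanced-scale : (a : ℕ) {g c n d : ℕ → ℕ} → Balanced g c n d →
                   Balanced (λ k → a * g k) (λ k → a * c k) (λ k → a * n k) (λ k → a * d k)
  Balanced-scale a {g} {c} {n} {d} bal k = begin
    a * g k + onePlusQℕ (λ j → a * c j) k ≡⟨ cong (a * g k +_) (onePlusQℕ-scale a c k) ⟩
    a * g k + a * onePlusQℕ c k           ≡⟨ sym (*-distribˡ-+ a _ _) ⟩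
    a * (g k + onePlusQℕ c k)             ≡⟨ cong (a *_) (bal k) ⟩
    a * (n k + onePlusQℕ d k)             ≡⟨ *-distribˡ-+ a _ _ ⟩
    a * n k + a * onePlusQℕ d k           ≡⟨ cong (a * n k +_) (sym (onePlusQℕ-scale a d k)) ⟩
    a * n k + onePlusQℕ (λ j → a * d j) k ∎
    where open ≡-Reasoning

  -- Orientations and edge insertion

  Pair : ℕ → Set
  Pair n = Fin n × Fin n

  orient : ∀ {n} → Pair n → Bool → Pair n
  orient p true  = p
  orient p false = Product.swap p

  arcs-∷ : ∀ {n} (p : Pair n) (L : List (Pair n)) b γ →
           arcs (mkGraph (p ∷ L)) (b ∷ γ) ≡ orient p b ∷ arcs (mkGraph L) γ
  arcs-∷ p L true  γ = refl
  arcs-∷ p L false γ = refl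

  orientations : (k : ℕ) → List (Vec Bool k)
  orientations = allVecs (true ∷ false ∷ [])

  sumOrientations : (k : ℕ) → (Vec Bool k → ℕ) → ℕ
  sumOrientations k F = sumOver (orientations k) F

  sumOrientations-suc : ∀ k (F : Vec Bool (suc k) → ℕ) →
                        sumOrientations (suc k) F
                        ≡ sumOrientations k (λ γ → F (true ∷ γ))
                          + sumOrientations k (λ γ → F (false ∷ γ))
  sumOrientations-suc k F = begin
    sumOver (map (true ∷_) Vs ++ map (false ∷_) Vs ++ []) F
      ≡⟨ sumOver-++ (map (true ∷_) Vs) _ F ⟩
    sumOver (map (true ∷_) Vs) F + sumOver (map (false ∷_) Vs ++ []) F
      ≡⟨ cong (sumOver (map (true ∷_) Vs) F +_)
              (trans (sumOver-++ (map (false ∷_) Vs) [] F) (+-identityʳ _)) ⟩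
    sumOver (map (true ∷_) Vs) F + sumOver (map (false ∷_) Vs) F
      ≡⟨ cong₂ _+_ (sumOver-map (true ∷_) Vs F) (sumOver-map (false ∷_) Vs F) ⟩
    sumOrientations k (λ γ → F (true ∷ γ)) + sumOrientations k (λ γ → F (false ∷ γ)) ∎
    where
    open ≡-Reasoning
    Vs = orientations k

  sumOrientations-by-head : ∀ {k l} (F : Vec Bool (suc k) → ℕ) (F′ : Vec Bool (suc l) → ℕ) →
                            (∀ b → sumOrientations k (λ γ → F (b ∷ γ))
                                   ≡ sumOrientations l (λ γ → F′ (b ∷ γ))) →
                            sumOrientations (suc k) F ≡ sumOrientations (suc l) F′
  sumOrientations-by-head {k} {l} F F′ same =
    trans (sumOrientations-suc k F)
          (trans (cong₂ _+_ (same true) (same false)) (sym (sumOrientations-suc l F′)))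

  record EdgeInsertion {n} (G′ G : Graph n) (o : Pair n) : Set where
    field
      insert     : Orientation G → Bool → Orientation G′
      edges-↭    : edges G′ ↭ o ∷ edges G
      arcs-↭     : ∀ γ b → arcs G′ (insert γ b) ↭ orient o b ∷ arcs G γ
      sum-insert : ∀ F → sumOrientations (length (edges G′)) F
                         ≡ sumOrientations (length (edges G)) (λ γ → F (insert γ true) + F (insert γ false))

  module _ {n : ℕ} where

    insertAt : (L : List (Pair n)) (i : Fin (length L)) →
               Vec Bool (length (removeAt L i)) → Bool → Vec Bool (length L)
    insertAt (p ∷ L) zero    γ       b = b ∷ γ
    insertAt (p ∷ L) (suc i) (c ∷ γ) b = c ∷ insertAt L i γ b

    removeAt-↭ : (L : List (Pair n)) (i : Fin (length L)) → L ↭ lookup L i ∷ removeAt L i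
    removeAt-↭ (p ∷ L) zero    = ↭-refl
    removeAt-↭ (p ∷ L) (suc i) = ↭-trans (prep p (removeAt-↭ L i)) (swap p (lookup L i) ↭-refl)

    arcs-insertAt : (L : List (Pair n)) (i : Fin (length L)) → ∀ γ b →
                    arcs (mkGraph L) (insertAt L i γ b)
                    ↭ orient (lookup L i) b ∷ arcs (mkGraph (removeAt L i)) γ
    arcs-insertAt (p ∷ L) zero    γ       b = ↭-reflexive (arcs-∷ p L b γ)
    arcs-insertAt (p ∷ L) (suc i) (c ∷ γ) b = begin
      arcs (mkGraph (p ∷ L)) (c ∷ insertAt L i γ b)
        ≡⟨ arcs-∷ p L c _ ⟩
      orient p c ∷ arcs (mkGraph L) (insertAt L i γ b)
        ↭⟨ prep (orient p c) (arcs-insertAt L i γ b) ⟩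
      orient p c ∷ orient (lookup L i) b ∷ arcs (mkGraph (removeAt L i)) γ
        ↭⟨ swap (orient p c) (orient (lookup L i) b) ↭-refl ⟩
      orient (lookup L i) b ∷ orient p c ∷ arcs (mkGraph (removeAt L i)) γ
        ≡⟨ cong (orient (lookup L i) b ∷_) (sym (arcs-∷ p (removeAt L i) c γ)) ⟩
      orient (lookup L i) b ∷ arcs (mkGraph (p ∷ removeAt L i)) (c ∷ γ) ∎
      where open PermutationReasoning

    sumOrientations-insertAt : (L : List (Pair n)) (i : Fin (length L)) → ∀ F →
                               sumOrientations (length L) F
                               ≡ sumOrientations (length (removeAt L i))
                                                 (λ γ → F (insertAt L i γ true) + F (insertAt L i γ false))
    sumOrientations-insertAt (p ∷ L) zero    F =
      trans (sumOrientations-suc (length L) F) (sym (sumOver-+ (orientations (length L)) _ _))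
    sumOrientations-insertAt (p ∷ L) (suc i) F =
      sumOrientations-by-head F
        (λ γ → F (insertAt (p ∷ L) (suc i) γ true) + F (insertAt (p ∷ L) (suc i) γ false))
        (λ b → sumOrientations-insertAt L i (λ γ → F (b ∷ γ)))

    removeAt-insertion : (G : Graph n) (i : Edge G) → EdgeInsertion G (deleteEdge G i) (endpoints G i)
    removeAt-insertion G i = record
      { insert     = insertAt (edges G) i
      ; edges-↭    = removeAt-↭ (edges G) i
      ; arcs-↭     = arcs-insertAt (edges G) i
      ; sum-insert = sumOrientations-insertAt (edges G) i
      }

    insertLast : (L : List (Pair n)) (o : Pair n) →
                 Vec Bool (length L) → Bool → Vec Bool (length (L ++ o ∷ []))
    insertLast []      o []      b = b ∷ []
    insertLast (p ∷ L) o (c ∷ γ) b = c ∷ insertLast L o γ b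

    arcs-insertLast : (L : List (Pair n)) (o : Pair n) → ∀ γ b →
                      arcs (mkGraph (L ++ o ∷ [])) (insertLast L o γ b) ≡ arcs (mkGraph L) γ ++ orient o b ∷ []
    arcs-insertLast []      o []      true  = refl
    arcs-insertLast []      o []      false = refl
    arcs-insertLast (p ∷ L) o (c ∷ γ) b =
      trans (arcs-∷ p (L ++ o ∷ []) c (insertLast L o γ b))
            (trans (cong (orient p c ∷_) (arcs-insertLast L o γ b))
                   (cong (_++ orient o b ∷ []) (sym (arcs-∷ p L c γ))))

    sumOrientations-insertLast : (L : List (Pair n)) (o : Pair n) → ∀ F →
                                 sumOrientations (length (L ++ o ∷ [])) F
                                 ≡ sumOrientations (length L)
                                                   (λ γ → F (insertLast L o γ true) + F (insertLast L o γ false))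
    sumOrientations-insertLast []      o F = sym (+-assoc (F (true ∷ [])) (F (false ∷ [])) 0)
    sumOrientations-insertLast (p ∷ L) o F =
      sumOrientations-by-head F
        (λ γ → F (insertLast (p ∷ L) o γ true) + F (insertLast (p ∷ L) o γ false))
        (λ b → sumOrientations-insertLast L o (λ γ → F (b ∷ γ)))

    insertLast-insertion : (G : Graph n) (o : Pair n) → EdgeInsertion (mkGraph (edges G ++ o ∷ [])) G o
    insertLast-insertion G o = record
      { insert     = insertLast (edges G) o
      ; edges-↭    = ↭-sym (∷↭∷ʳ o (edges G))
      ; arcs-↭     = λ γ b → ↭-trans (↭-reflexive (arcs-insertLast (edges G) o γ b))
                                     (↭-sym (∷↭∷ʳ (orient o b) (arcs G γ)))
      ; sum-insert = sumOrientations-insertLast (edges G) o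
      }

    pairMap : (Fin n → Fin n) → Pair n → Pair n
    pairMap r p = r (proj₁ p) , r (proj₂ p)

    relabel : (r : Fin n → Fin n) (L : List (Pair n)) →
              Vec Bool (length L) → Vec Bool (length (map (pairMap r) L))
    relabel r []      []      = []
    relabel r (p ∷ L) (c ∷ γ) = c ∷ relabel r L γ

    arcs-relabel : (r : Fin n → Fin n) (L : List (Pair n)) → ∀ γ →
                   arcs (mkGraph (map (pairMap r) L)) (relabel r L γ) ≡ map (pairMap r) (arcs (mkGraph L) γ)
    arcs-relabel r []      []          = refl
    arcs-relabel r (p ∷ L) (true ∷ γ)  = cong (pairMap r p ∷_) (arcs-relabel r L γ)
    arcs-relabel r (p ∷ L) (false ∷ γ) = cong (pairMap r (Product.swap p) ∷_) (arcs-relabel r L γ)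

    sumOrientations-relabel : (r : Fin n → Fin n) (L : List (Pair n)) → ∀ F →
                              sumOrientations (length (map (pairMap r) L)) F
                              ≡ sumOrientations (length L) (λ γ → F (relabel r L γ))
    sumOrientations-relabel r []      F = refl
    sumOrientations-relabel r (p ∷ L) F =
      sumOrientations-by-head F (λ γ → F (relabel r (p ∷ L) γ))
        (λ b → sumOrientations-relabel r L (λ γ → F (b ∷ γ)))

  module _ {n : ℕ} {G′ G : Graph n} {o : Pair n} (I : EdgeInsertion G′ G o) where
    open EdgeInsertion I

    sum-insert-weighted : (w′ : Orientation G′ → Bool) (w : Orientation G → Bool) →
                          (∀ γ b → w′ (insert γ b) ≡ w γ) → (f : Orientation G′ → ℕ) →
                          sumOrientations (length (edges G′)) (λ γ′ → indicator (w′ γ′) * f γ′)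
                          ≡ sumOrientations (length (edges G))
                                            (λ γ → indicator (w γ) * (f (insert γ true) + f (insert γ false)))
    sum-insert-weighted w′ w same f = trans (sum-insert _) (sumOver-cong (orientations _) λ γ →
      trans (cong₂ _+_ (cong (λ b → indicator b * f (insert γ true)) (same γ true))
                       (cong (λ b → indicator b * f (insert γ false)) (same γ false)))
            (sym (*-distribˡ-+ (indicator (w γ)) _ _)))

  -- Paths and acyclicity

  AcyclicRel : {A : Set} → (A → A → Set) → Set
  AcyclicRel {A} R = ∀ (a : A) → ¬ TransClosure R a a

  Reachable : {A : Set} → (A → A → Set) → A → A → Set
  Reachable R x y = x ≡ y ⊎ TransClosure R x y

  module _ {A : Set} {R : A → A → Set} where

    ⁺-then-reachable : ∀ {x y z} → TransClosure R x y → Reachable R y z → TransClosure R x z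
    ⁺-then-reachable xy (inj₁ refl) = xy
    ⁺-then-reachable xy (inj₂ yz)   = xy ++⁺ yz

    reachable-then-⁺ : ∀ {x y z} → Reachable R x y → TransClosure R y z → TransClosure R x z
    reachable-then-⁺ (inj₁ refl) yz = yz
    reachable-then-⁺ (inj₂ xy)   yz = xy ++⁺ yz

    reachable-trans : ∀ {x y z} → Reachable R x y → Reachable R y z → Reachable R x z
    reachable-trans (inj₁ refl) yz = yz
    reachable-trans (inj₂ xy)   yz = inj₂ (⁺-then-reachable xy yz)

    no-path-from-untouched : ∀ {w y} → (∀ {a b} → R a b → a ≢ w × b ≢ w) → ¬ TransClosure R w y
    no-path-from-untouched untouched [ wb ]   = proj₁ (untouched wb) refl
    no-path-from-untouched untouched (wb ∷ _) = proj₁ (untouched wb) refl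

    no-path-to-untouched : ∀ {x w} → (∀ {a b} → R a b → a ≢ w × b ≢ w) → ¬ TransClosure R x w
    no-path-to-untouched untouched [ aw ]     = proj₂ (untouched aw) refl
    no-path-to-untouched untouched (_ ∷ path) = no-path-to-untouched untouched path

  ⁺-map : {A B : Set} {R : A → A → Set} {S : B → B → Set} (f : A → B) →
          (∀ {x y} → R x y → S (f x) (f y)) → ∀ {x y} → TransClosure R x y → TransClosure S (f x) (f y)
  ⁺-map f hom [ xy ]      = [ hom xy ]
  ⁺-map f hom (xy ∷ path) = hom xy ∷ ⁺-map f hom path

  module _ {A : Set} {R S : A → A → Set} where

    ⁺-mono : (∀ {x y} → R x y → S x y) → ∀ {x y} → TransClosure R x y → TransClosure S x y
    ⁺-mono = ⁺-map (λ x → x)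

    acyclic-mono : (∀ {x y} → R x y → S x y) → AcyclicRel S → AcyclicRel R
    acyclic-mono R⊆S acyclic a cycle = acyclic a (⁺-mono R⊆S cycle)

  module _ {A : Set} {R R′ : A → A → Set} {s t : A}
           (split : ∀ {x y} → R′ x y → (x ≡ s × y ≡ t) ⊎ R x y)
           (t≢s : t ≢ s) (no-return : ¬ TransClosure R t s) where

    private
      no-reach-back : ¬ Reachable R t s
      no-reach-back (inj₁ t≡s)  = t≢s t≡s
      no-reach-back (inj₂ path) = no-return path

      -- with no way back from t to s, a path uses the new arc s → t at most once
      decompose : ∀ {x y} → TransClosure R′ x y → TransClosure R x y ⊎ (Reachable R x s × Reachable R t y)
      decompose [ xy ] with split xy
      ... | inj₁ (refl , refl) = inj₂ (inj₁ refl , inj₁ refl)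
      ... | inj₂ xy′           = inj₁ [ xy′ ]
      decompose (xz ∷ path) with split xz | decompose path
      ... | inj₁ (refl , refl) | inj₁ zy        = inj₂ (inj₁ refl , inj₂ zy)
      ... | inj₁ (refl , refl) | inj₂ (ts , _)  = ⊥-elim (no-reach-back ts)
      ... | inj₂ xz′           | inj₁ zy        = inj₁ (xz′ ∷ zy)
      ... | inj₂ xz′           | inj₂ (zs , ty) = inj₂ (inj₂ (⁺-then-reachable [ xz′ ] zs) , ty)

    acyclic-addArc : AcyclicRel R → AcyclicRel R′
    acyclic-addArc acyclic a cycle with decompose cycle
    ... | inj₁ cycle′    = acyclic a cycle′
    ... | inj₂ (as , ta) = no-reach-back (reachable-trans ta as)

  Twins : {A : Set} → A → A → A → A → Set
  Twins u v a b = (a ≡ u × b ≡ v) ⊎ (a ≡ v × b ≡ u)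

  module _ {A : Set} {u v : A} where

    twins-sym : ∀ {a b} → Twins u v a b → Twins u v b a
    twins-sym (inj₁ (a≡u , b≡v)) = inj₂ (b≡v , a≡u)
    twins-sym (inj₂ (a≡v , b≡u)) = inj₁ (b≡u , a≡v)

    twins-equal-or-twins : ∀ {a b c d} → Twins u v a b → Twins u v c d → a ≡ c ⊎ Twins u v a c
    twins-equal-or-twins (inj₁ (a≡u , _)) (inj₁ (c≡u , _)) = inj₁ (trans a≡u (sym c≡u))
    twins-equal-or-twins (inj₁ (a≡u , _)) (inj₂ (c≡v , _)) = inj₂ (inj₁ (a≡u , c≡v))
    twins-equal-or-twins (inj₂ (a≡v , _)) (inj₁ (c≡u , _)) = inj₂ (inj₂ (a≡v , c≡u))
    twins-equal-or-twins (inj₂ (a≡v , _)) (inj₂ (c≡v , _)) = inj₁ (trans a≡v (sym c≡v))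

    twins-unique : u ≢ v → ∀ {a b c} → Twins u v a b → Twins u v a c → b ≡ c
    twins-unique u≢v (inj₁ (_ , b≡v)) (inj₁ (_ , c≡v)) = trans b≡v (sym c≡v)
    twins-unique u≢v (inj₁ (a≡u , _)) (inj₂ (a≡v , _)) = ⊥-elim (u≢v (trans (sym a≡u) a≡v))
    twins-unique u≢v (inj₂ (a≡v , _)) (inj₁ (a≡u , _)) = ⊥-elim (u≢v (trans (sym a≡u) a≡v))
    twins-unique u≢v (inj₂ (_ , b≡u)) (inj₂ (_ , c≡u)) = trans b≡u (sym c≡u)

  module _ {A : Set} {R R′ : A → A → Set} {u v : A} (r : A → A) (u≢v : u ≢ v)
           (fibres : ∀ {a b} → r a ≡ r b → a ≡ b ⊎ Twins u v a b)
           (lift : ∀ {x y} → R′ x y → ∃₂ λ x′ y′ → R x′ y′ × r x′ ≡ x × r y′ ≡ y)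
           (no-uv : ¬ TransClosure R u v) (no-vu : ¬ TransClosure R v u) where

    private
      separated : ∀ {a b} → Twins u v a b → ¬ TransClosure R a b
      separated (inj₁ (refl , refl)) = no-uv
      separated (inj₂ (refl , refl)) = no-vu

      -- a path of R′ lifts to R except for at most one jump between the twins u and v
      data Lift (x y : A) : Set where
        whole  : ∀ {x′ y′} → r x′ ≡ x → r y′ ≡ y → TransClosure R x′ y′ → Lift x y
        jumped : ∀ {x′ s s′ y′} → r x′ ≡ x → r y′ ≡ y → Twins u v s s′ →
                 TransClosure R x′ s → Reachable R s′ y′ → Lift x y

      lift⁺ : ∀ {x y} → TransClosure R′ x y → Lift x y
      lift⁺ [ xy ] with lift xy
      ... | _ , _ , xy′ , rx , ry = whole rx ry [ xy′ ]
      lift⁺ (xz ∷ path) with lift xz | lift⁺ path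
      ... | _ , q , xz′ , rx , rq | whole rz ry zy with fibres (trans rq (sym rz))
      ...   | inj₁ refl = whole rx ry (xz′ ∷ zy)
      ...   | inj₂ tw   = jumped rx ry tw [ xz′ ] (inj₂ zy)
      lift⁺ (xz ∷ path) | _ , q , xz′ , rx , rq | jumped rz ry tw zs s′y with fibres (trans rq (sym rz))
      ...   | inj₁ refl = jumped rx ry tw (xz′ ∷ zs) s′y
      ...   | inj₂ tw′ with twins-equal-or-twins (twins-sym tw′) tw
      ...     | inj₂ tw″ = ⊥-elim (separated tw″ zs)
      ...     | inj₁ refl with twins-unique u≢v (twins-sym tw′) tw
      ...       | refl = whole rx ry (⁺-then-reachable [ xz′ ] s′y)

    acyclic-merge : AcyclicRel R → AcyclicRel R′
    acyclic-merge acyclic a cycle with lift⁺ cycle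
    ... | whole rx ry path with fibres (trans rx (sym ry))
    ...   | inj₁ refl = acyclic _ path
    ...   | inj₂ tw   = separated tw path
    acyclic-merge acyclic a cycle | jumped rx ry tw xs s′y with fibres (trans rx (sym ry))
    ...   | inj₁ refl = separated (twins-sym tw) (reachable-then-⁺ s′y xs)
    ...   | inj₂ tw′ with twins-equal-or-twins tw′ tw
    ...     | inj₁ refl = acyclic _ xs
    ...     | inj₂ tw″  = separated tw″ xs

  -- Simple paths and bridges

  lastOf : {A : Set} → A → List A → A
  lastOf x []       = x
  lastOf _ (y ∷ ys) = lastOf y ys

  module _ {A : Set} where

    lookup-lastOf : (x : A) (xs : List A) → lookup (x ∷ xs) (fromℕ (length xs)) ≡ lastOf x xs
    lookup-lastOf x []       = refl
    lookup-lastOf x (y ∷ ys) = lookup-lastOf y ys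

    unique-lookup-injective : ∀ {xs : List A} → Unique xs → ∀ i j → lookup xs i ≡ lookup xs j → i ≡ j
    unique-lookup-injective (_ ∷ _)   zero    zero    _  = refl
    unique-lookup-injective (x∉ ∷ _)  zero    (suc j) eq = ⊥-elim (All.lookup x∉ (∈-lookup j) eq)
    unique-lookup-injective (x∉ ∷ _)  (suc i) zero    eq = ⊥-elim (All.lookup x∉ (∈-lookup i) (sym eq))
    unique-lookup-injective (_ ∷ xs!) (suc i) (suc j) eq = cong suc (unique-lookup-injective xs! i j eq)

    linked-lookup : ∀ {R : A → A → Set} (x : A) (xs : List A) → Linked R (x ∷ xs) →
                    (i : Fin (length xs)) → R (lookup (x ∷ xs) (inject₁ i)) (lookup (x ∷ xs) (suc i))
    linked-lookup x (y ∷ ys) (xy ∷ _)      zero    = xy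
    linked-lookup x (y ∷ ys) (_  ∷ linked) (suc i) = linked-lookup y ys linked i

  module _ {A : Set} (_≟ᴬ_ : DecidableEquality A) (R : A → A → Set) where

    record SimplePath (x y : A) : Set where
      field
        rest   : List A
        unique : Unique (x ∷ rest)
        linked : Linked R (x ∷ rest)
        ends   : lastOf x rest ≡ y

    private
      trivial : ∀ {x} → SimplePath x x
      trivial = record { rest = [] ; unique = [] ∷ [] ; linked = [-] ; ends = refl }

      suffix : ∀ {x y z} (p : SimplePath x y) → z ∈ (x ∷ SimplePath.rest p) → SimplePath z y
      suffix p (here refl) = p
      suffix record { rest = [] } (there ())
      suffix record { rest = x′ ∷ rest ; unique = _ ∷ unique ; linked = linked ; ends = ends } (there z∈) =
        suffix (record { rest = rest ; unique = unique ; linked = Linked.tail linked ; ends = ends }) z∈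

      prepend : ∀ {x y z} → R x y → SimplePath y z → SimplePath x z
      prepend {x} {y} xy p with any? (x ≟ᴬ_) (y ∷ SimplePath.rest p)
      ... | yes x∈ = suffix p x∈
      ... | no  x∉ = record
        { rest   = y ∷ rest
        ; unique = ¬Any⇒All¬ (y ∷ rest) x∉ ∷ unique
        ; linked = xy ∷ linked
        ; ends   = ends
        }
        where open SimplePath p

    loop-erase : ∀ {x y} → TransClosure R x y → SimplePath x y
    loop-erase [ xy ]      = prepend xy trivial
    loop-erase (xy ∷ path) = prepend xy (loop-erase path)

  module _ {n : ℕ} where

    sameEdge-sym : {p q : Pair n} → SameEdge p q → SameEdge q p
    sameEdge-sym (inj₁ refl) = inj₁ refl
    sameEdge-sym (inj₂ refl) = inj₂ refl

    removed-edge-not-parallel : (L : List (Pair n)) (i : Fin (length L)) →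
                                AllPairs (λ p q → ¬ SameEdge p q) L →
                                ∀ {p} → p ∈ removeAt L i → ¬ SameEdge p (lookup L i)
    removed-edge-not-parallel (q ∷ L) zero    (q∦ ∷ _) p∈          same =
      All.lookup q∦ p∈ (sameEdge-sym same)
    removed-edge-not-parallel (q ∷ L) (suc i) (q∦ ∷ _) (here refl) same =
      All.lookup q∦ (∈-lookup i) same
    removed-edge-not-parallel (q ∷ L) (suc i) (_ ∷ ∦)  (there p∈)  same =
      removed-edge-not-parallel L i ∦ p∈ same

    arc⇒adj : (H : Graph n) (γ : Orientation H) → ∀ {a b} → Arc H γ a b → Adj H a b
    arc⇒adj H γ = go (edges H) γ
      where
      go : (L : List (Pair n)) (γ : Orientation (mkGraph L)) →
           ∀ {a b} → Arc (mkGraph L) γ a b → Adj (mkGraph L) a b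
      go []      []          ()
      go (p ∷ L) (true  ∷ γ) (here refl) = inj₁ (here refl)
      go (p ∷ L) (false ∷ γ) (here refl) = inj₂ (here refl)
      go (p ∷ L) (true  ∷ γ) (there a∈)  = Sum.map there there (go L γ a∈)
      go (p ∷ L) (false ∷ γ) (there a∈)  = Sum.map there there (go L γ a∈)

  inNoCycle⇒bridge : ∀ {n} (G : Graph n) (e : Edge G) → IsSimple G → InNoCycle G e →
                     ¬ TransClosure (Adj (deleteEdge G e)) (proj₁ (endpoints G e)) (proj₂ (endpoints G e))
  inNoCycle⇒bridge G e (no-loops , no-parallels) no-cycle path = from-simple-path (loop-erase _≟_ _ path)
    where
    L = edges G
    u = proj₁ (endpoints G e)
    v = proj₂ (endpoints G e)

    in-G : ∀ {p} → p ∈ removeAt L e → p ∈ L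
    in-G p∈ = ∈-resp-↭ (↭-sym (removeAt-↭ L e)) (there p∈)

    from-simple-path : SimplePath _≟_ (Adj (deleteEdge G e)) u v → ⊥
    from-simple-path record { rest = [] ; ends = u≡v } = All.lookup no-loops (∈-lookup e) u≡v
    from-simple-path record { rest = a ∷ [] ; linked = ua ∷ _ ; ends = refl } with ua
    ... | inj₁ uv∈ = removed-edge-not-parallel L e no-parallels uv∈ (inj₁ refl)
    ... | inj₂ vu∈ = removed-edge-not-parallel L e no-parallels vu∈ (inj₂ refl)
    from-simple-path record { rest = rest@(_ ∷ _ ∷ _) ; unique = unique ; linked = linked ; ends = ends } =
      no-cycle cycle (inj₂ (inj₂ (cong (_, u) last≡v)))
      where
      vertex = lookup (u ∷ rest)
      last≡v : vertex (fromℕ (length rest)) ≡ v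
      last≡v = trans (lookup-lastOf u rest) ends
      cycle : Cycle G
      cycle = record
        { k     = length rest
        ; len≥3 = s≤s (s≤s z≤n)
        ; c     = vertex
        ; inj   = unique-lookup-injective unique _ _
        ; step  = λ i → Sum.map in-G in-G (linked-lookup u rest linked i)
        ; close = subst (λ w → Adj G w u) (sym last≡v) (inj₂ (∈-lookup e))
        }

  module _ {n : ℕ} {G′ G : Graph n} {o : Pair n} (I : EdgeInsertion G′ G o) where
    open EdgeInsertion I

    arc-insert : ∀ γ b {x y} → Arc G′ (insert γ b) x y →
                 (x ≡ proj₁ (orient o b) × y ≡ proj₂ (orient o b)) ⊎ Arc G γ x y
    arc-insert γ b xy∈ with ∈-resp-↭ (arcs-↭ γ b) xy∈
    ... | here refl  = inj₁ (refl , refl)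
    ... | there xy∈′ = inj₂ xy∈′

    acyclic-insert⇔ : ∀ γ → proj₁ o ≢ proj₂ o →
                      ¬ TransClosure (Arc G γ) (proj₁ o) (proj₂ o) →
                      ¬ TransClosure (Arc G γ) (proj₂ o) (proj₁ o) →
                      ∀ b → Acyclic G′ (insert γ b) ⇔ Acyclic G γ
    acyclic-insert⇔ γ o₁≢o₂ no-12 no-21 b = mk⇔
      (acyclic-mono (λ xy∈ → ∈-resp-↭ (↭-sym (arcs-↭ γ b)) (there xy∈)))
      (acyclic-addArc (arc-insert γ b) (target≢source b) (no-return b))
      where
      target≢source : ∀ b → proj₂ (orient o b) ≢ proj₁ (orient o b)
      target≢source true  = o₁≢o₂ ∘ sym
      target≢source false = o₁≢o₂
      no-return : ∀ b → ¬ TransClosure (Arc G γ) (proj₂ (orient o b)) (proj₁ (orient o b))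
      no-return true  = no-21
      no-return false = no-12

  module _ {n : ℕ} where

    rename : Fin n → Fin n → Fin n → Fin n
    rename u v w = if does (w ≟ v) then u else w

    merge : Graph n → Fin n → Fin n → Graph n
    merge D u v = mkGraph (map (pairMap (rename u v)) (edges D))

    module _ (u v : Fin n) where

      rename-cases : ∀ w → (w ≡ v × rename u v w ≡ u) ⊎ (w ≢ v × rename u v w ≡ w)
      rename-cases w with w ≟ v
      ... | yes w≡v = inj₁ (w≡v , refl)
      ... | no  w≢v = inj₂ (w≢v , refl)

      rename-fibres : ∀ {a b} → rename u v a ≡ rename u v b → a ≡ b ⊎ Twins u v a b
      rename-fibres {a} {b} ra≡rb with rename-cases a | rename-cases b
      ... | inj₁ (a≡v , _)  | inj₁ (b≡v , _)  = inj₁ (trans a≡v (sym b≡v))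
      ... | inj₁ (a≡v , ra) | inj₂ (_ , rb)   = inj₂ (inj₂ (a≡v , trans (sym rb) (trans (sym ra≡rb) ra)))
      ... | inj₂ (_ , ra)   | inj₁ (b≡v , rb) = inj₂ (inj₁ (trans (sym ra) (trans ra≡rb rb) , b≡v))
      ... | inj₂ (_ , ra)   | inj₂ (_ , rb)   = inj₁ (trans (sym ra) (trans ra≡rb rb))

      rename-≢ : u ≢ v → ∀ w → rename u v w ≢ v
      rename-≢ u≢v w with rename-cases w
      ... | inj₁ (_ , rw)   = λ rw≡v → u≢v (trans (sym rw) rw≡v)
      ... | inj₂ (w≢v , rw) = λ rw≡v → w≢v (trans (sym rw) rw≡v)

    module _ (D : Graph n) (u v : Fin n) where
      private
        M = merge D u v
        r = rename u v

      merge-isolates : u ≢ v → ∀ {x y} → Adj M x y → x ≢ v × y ≢ v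
      merge-isolates u≢v (inj₁ xy∈) with ∈-map⁻ (pairMap r) xy∈
      ... | p , _ , refl = rename-≢ u v u≢v (proj₁ p) , rename-≢ u v u≢v (proj₂ p)
      merge-isolates u≢v (inj₂ yx∈) with ∈-map⁻ (pairMap r) yx∈
      ... | p , _ , refl = rename-≢ u v u≢v (proj₂ p) , rename-≢ u v u≢v (proj₁ p)

      arc-merge-lift : ∀ γ {x y} → Arc M (relabel r (edges D) γ) x y →
                       ∃₂ λ x′ y′ → Arc D γ x′ y′ × r x′ ≡ x × r y′ ≡ y
      arc-merge-lift γ xy∈ with ∈-map⁻ (pairMap r) (subst (_ ∈_) (arcs-relabel r (edges D) γ) xy∈)
      ... | p , p∈ , refl = proj₁ p , proj₂ p , p∈ , refl , refl

      arc-merge-push : ∀ γ {x y} → Arc D γ x y → Arc M (relabel r (edges D) γ) (r x) (r y)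
      arc-merge-push γ xy∈ = subst (_ ∈_) (sym (arcs-relabel r (edges D) γ)) (∈-map⁺ (pairMap r) xy∈)

      acyclic-merge⇔ : u ≢ v → ∀ γ → ¬ TransClosure (Arc D γ) u v → ¬ TransClosure (Arc D γ) v u →
                       Acyclic M (relabel r (edges D) γ) ⇔ Acyclic D γ
      acyclic-merge⇔ u≢v γ no-uv no-vu = mk⇔
        (λ acyclic a cycle → acyclic (r a) (⁺-map r (arc-merge-push γ) cycle))
        (acyclic-merge r u≢v (rename-fibres u v) (arc-merge-lift γ) no-uv no-vu)

  -- Colourings

  qPowerCoeff : Bool → ℕ → ℕ → ℕ
  qPowerCoeff w a k = indicator (w ∧ does (a ≟ℕ k))

  qPowerCoeff-suc : ∀ w a k → qPowerCoeff w (suc a) k ≡ qTimes (qPowerCoeff w a) k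
  qPowerCoeff-suc w a zero    = cong indicator (∧-zeroʳ w)
  qPowerCoeff-suc w a (suc k) = refl

  qPowerCoeff-one-ascent : ∀ w a k (x y : Bool) → x ≡ not y →
                           qPowerCoeff w (indicator x + a) k + qPowerCoeff w (indicator y + a) k
                           ≡ onePlusQℕ (qPowerCoeff w a) k
  qPowerCoeff-one-ascent w a k false true  refl = cong (qPowerCoeff w a k +_) (qPowerCoeff-suc w a k)
  qPowerCoeff-one-ascent w a k true  false refl =
    trans (+-comm _ (qPowerCoeff w a k)) (cong (qPowerCoeff w a k +_) (qPowerCoeff-suc w a k))

  <-exclusive : ∀ {m} (i j : Fin m) → i ≢ j → does (toℕ i <? toℕ j) ≡ not (does (toℕ j <? toℕ i))
  <-exclusive i j i≢j = exclusive (toℕ i <? toℕ j) (toℕ j <? toℕ i)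
    where
    exclusive : (i<?j : Dec (toℕ i < toℕ j)) (j<?i : Dec (toℕ j < toℕ i)) → does i<?j ≡ not (does j<?i)
    exclusive (yes i<j) (yes j<i) = ⊥-elim (<-asym i<j j<i)
    exclusive (yes _)   (no  _)   = refl
    exclusive (no  _)   (yes _)   = refl
    exclusive (no  i≮j) (no  j≮i) =
      ⊥-elim (i≢j (toℕ-injective (≤-antisym (≮⇒≥ j≮i) (≮⇒≥ i≮j))))

  module Colourings {n m : ℕ} (α : Vec ℕ m) where

    colourings : List (Colouring n m)
    colourings = allVecs (allFin m) n

    colour : Colouring n m → Fin n → Fin m
    colour κ = Vec.lookup κ

    ascends? : (κ : Colouring n m) (p : Pair n) → Dec (toℕ (colour κ (proj₁ p)) < toℕ (colour κ (proj₂ p)))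
    ascends? κ p = toℕ (colour κ (proj₁ p)) <? toℕ (colour κ (proj₂ p))

    contributes : Graph n → Colouring n m → Bool
    contributes H κ = does (proper? H κ) ∧ does (hasMonomial? κ α)

    chiTerm : (H : Graph n) → Orientation H → Colouring n m → ℕ → ℕ
    chiTerm H γ κ = qPowerCoeff (contributes H κ) (asc H γ κ)

    chiCoeff-sum : (H : Graph n) (γ : Orientation H) →
                   ∀ k → chiCoeff H γ m α k ≡ sumOver colourings (λ κ → chiTerm H γ κ k)
    chiCoeff-sum H γ k =
      trans (length-filter (λ κ → proper? H κ ×-dec (hasMonomial? κ α ×-dec asc H γ κ ≟ℕ k)) colourings)
            (sumOver-cong colourings λ κ → cong indicator
              (sym (∧-assoc (does (proper? H κ)) (does (hasMonomial? κ α)) (does (asc H γ κ ≟ℕ k)))))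

    module _ {G′ G : Graph n} {o : Pair n} (I : EdgeInsertion G′ G o) (κ : Colouring n m) where
      open EdgeInsertion I

      proper-insert : Proper G′ κ ⇔ (Proper G κ × colour κ (proj₁ o) ≢ colour κ (proj₂ o))
      proper-insert = mk⇔
        (λ proper′ → let proper-o∷ = All-resp-↭ edges-↭ proper′
                     in All.tail proper-o∷ , All.head proper-o∷)
        (λ (proper , o-proper) → All-resp-↭ (↭-sym edges-↭) (o-proper ∷ proper))

      asc-insert : ∀ γ b → asc G′ (insert γ b) κ ≡ indicator (does (ascends? κ (orient o b))) + asc G γ κ
      asc-insert γ b =
        trans (↭-length (filter-↭ (ascends? κ) (arcs-↭ γ b))) (length-filter-∷ (ascends? κ) _ _)

      chiTerm-insert-monochromatic : colour κ (proj₁ o) ≡ colour κ (proj₂ o) →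
                                     ∀ γ b k → chiTerm G′ (insert γ b) κ k ≡ 0
      chiTerm-insert-monochromatic same γ b k
        rewrite dec-false (proper? G′ κ) (λ proper′ → proj₂ (Equivalence.to proper-insert proper′) same)
        = refl

      chiTerm-insert-bichromatic : colour κ (proj₁ o) ≢ colour κ (proj₂ o) → ∀ γ k →
                                   chiTerm G′ (insert γ true) κ k + chiTerm G′ (insert γ false) κ k
                                   ≡ onePlusQℕ (chiTerm G γ κ) k
      chiTerm-insert-bichromatic distinct γ k
        rewrite does-⇔ (mk⇔ (proj₁ ∘ Equivalence.to proper-insert)
                            (λ proper → Equivalence.from proper-insert (proper , distinct)))
                       (proper? G′ κ) (proper? G κ)
              | asc-insert γ true | asc-insert γ false
        = qPowerCoeff-one-ascent (contributes G κ) (asc G γ κ) k _ _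
            (<-exclusive (colour κ (proj₁ o)) (colour κ (proj₂ o)) distinct)

    module _ (D : Graph n) (u v : Fin n) (κ : Colouring n m) (same : colour κ u ≡ colour κ v) where
      private
        M = merge D u v
        r = rename u v

      colour-rename : ∀ w → colour κ (r w) ≡ colour κ w
      colour-rename w with rename-cases u v w
      ... | inj₁ (w≡v , rw) = trans (cong (colour κ) rw) (trans same (cong (colour κ) (sym w≡v)))
      ... | inj₂ (_ , rw)   = cong (colour κ) rw

      proper-merge : Proper M κ ⇔ Proper D κ
      proper-merge = mk⇔
        (λ proper → All.map (λ ne c → ne (trans (colour-rename _) (trans c (sym (colour-rename _)))))
                            (All-map⁻ proper))
        (λ proper → All-map⁺ (All.map (λ ne c → ne (trans (sym (colour-rename _)) (trans c (colour-rename _))))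
                                      proper))

      asc-merge : ∀ γ → asc M (relabel r (edges D) γ) κ ≡ asc D γ κ
      asc-merge γ = trans (cong (λ as → length (filter (ascends? κ) as)) (arcs-relabel r (edges D) γ))
                          (length-filter-map (ascends? κ) (pairMap r) ascends-same (arcs D γ))
        where
        ascends-same : ∀ p → does (ascends? κ (pairMap r p)) ≡ does (ascends? κ p)
        ascends-same p =
          cong₂ (λ i j → does (toℕ i <? toℕ j)) (colour-rename (proj₁ p)) (colour-rename (proj₂ p))

      chiTerm-merge : ∀ γ k → chiTerm M (relabel r (edges D) γ) κ k ≡ chiTerm D γ κ k
      chiTerm-merge γ k rewrite does-⇔ proper-merge (proper? M κ) (proper? D κ) | asc-merge γ = refl

  TchiCoeffℕ : AcyclicDecider → ∀ {n} (H : Graph n) (m : ℕ) → Vec ℕ m → ℕ → ℕ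
  TchiCoeffℕ acyc? H m α k =
    sumℕ (map (λ γ → chiCoeff H γ m α k) (filter (acyc? H) (orientations (length (edges H)))))

  TchiCoeffℕ-sumOrientations : (acyc? : AcyclicDecider) {n : ℕ} (H : Graph n) (m : ℕ) (α : Vec ℕ m) →
                               ∀ k → TchiCoeffℕ acyc? H m α k
                               ≡ sumOrientations (length (edges H))
                                                 (λ γ → indicator (does (acyc? H γ)) * chiCoeff H γ m α k)
  TchiCoeffℕ-sumOrientations acyc? H m α k =
    sumOver-filter (acyc? H) (orientations (length (edges H))) (λ γ → chiCoeff H γ m α k)

  module _ (acyc? : AcyclicDecider) {n : ℕ} (G : Graph n) (e : Edge G)
           (simple : IsSimple G) (no-cycle : InNoCycle G e) (m : ℕ) (α : Vec ℕ m) where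

    open Colourings {n} α
    private
      u = proj₁ (endpoints G e)
      v = proj₂ (endpoints G e)
      D = deleteEdge G e
      -- by definition this is merge D u v (rename is the renaming used in Defs)
      C = nearContractDel G e
      N = nearContract G e

      G-insertion : EdgeInsertion G D (endpoints G e)
      G-insertion = removeAt-insertion G e

      N-insertion : EdgeInsertion N C (endpoints G e)
      N-insertion = insertLast-insertion C (endpoints G e)

      toG : Orientation D → Bool → Orientation G
      toG = EdgeInsertion.insert G-insertion

      toC : Orientation D → Orientation C
      toC = relabel (rename u v) (edges D)

      toN : Orientation D → Bool → Orientation N
      toN γ = EdgeInsertion.insert N-insertion (toC γ)

      χ : (H : Graph n) → Orientation H → ℕ → ℕ
      χ H γ k = chiCoeff H γ m α k

      u≢v : u ≢ v
      u≢v = All.lookup (proj₁ simple) (∈-lookup e)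

      no-uv : ∀ γ → ¬ TransClosure (Arc D γ) u v
      no-uv γ = inNoCycle⇒bridge G e simple no-cycle ∘ ⁺-mono (arc⇒adj D γ)

      no-vu : ∀ γ → ¬ TransClosure (Arc D γ) v u
      no-vu γ = inNoCycle⇒bridge G e simple no-cycle ∘ symmetric _ Sum.swap ∘ ⁺-mono (arc⇒adj D γ)

      acyclic-G : ∀ γ b → does (acyc? G (toG γ b)) ≡ does (acyc? D γ)
      acyclic-G γ b =
        does-⇔ (acyclic-insert⇔ G-insertion γ u≢v (no-uv γ) (no-vu γ) b) (acyc? G (toG γ b)) (acyc? D γ)

      acyclic-C : ∀ γ → does (acyc? C (toC γ)) ≡ does (acyc? D γ)
      acyclic-C γ = does-⇔ (acyclic-merge⇔ D u v u≢v γ (no-uv γ) (no-vu γ)) (acyc? C (toC γ)) (acyc? D γ)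

      acyclic-N : ∀ γC b → does (acyc? N (EdgeInsertion.insert N-insertion γC b)) ≡ does (acyc? C γC)
      acyclic-N γC b = does-⇔ (acyclic-insert⇔ N-insertion γC u≢v no-uv′ no-vu′ b) (acyc? N _) (acyc? C γC)
        where
        v-isolated : ∀ {x y} → Arc C γC x y → x ≢ v × y ≢ v
        v-isolated = merge-isolates D u v u≢v ∘ arc⇒adj C γC
        no-uv′ : ¬ TransClosure (Arc C γC) u v
        no-uv′ = no-path-to-untouched v-isolated
        no-vu′ : ¬ TransClosure (Arc C γC) v u
        no-vu′ = no-path-from-untouched v-isolated

      balanced-per-colouring : ∀ γ κ →
        Balanced (λ k → chiTerm G (toG γ true) κ k + chiTerm G (toG γ false) κ k) (chiTerm C (toC γ) κ)
                 (λ k → chiTerm N (toN γ true) κ k + chiTerm N (toN γ false) κ k) (chiTerm D γ κ)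
      balanced-per-colouring γ κ k with colour κ u ≟ colour κ v
      ... | no distinct = begin
        (chiTerm G (toG γ true) κ k + chiTerm G (toG γ false) κ k) + onePlusQℕ (chiTerm C (toC γ) κ) k
          ≡⟨ cong (_+ onePlusQℕ (chiTerm C (toC γ) κ) k)
                  (chiTerm-insert-bichromatic G-insertion κ distinct γ k) ⟩
        onePlusQℕ (chiTerm D γ κ) k + onePlusQℕ (chiTerm C (toC γ) κ) k
          ≡⟨ +-comm (onePlusQℕ (chiTerm D γ κ) k) _ ⟩
        onePlusQℕ (chiTerm C (toC γ) κ) k + onePlusQℕ (chiTerm D γ κ) k
          ≡⟨ cong (_+ onePlusQℕ (chiTerm D γ κ) k)
                  (sym (chiTerm-insert-bichromatic N-insertion κ distinct (toC γ) k)) ⟩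
        (chiTerm N (toN γ true) κ k + chiTerm N (toN γ false) κ k) + onePlusQℕ (chiTerm D γ κ) k ∎
        where open ≡-Reasoning
      ... | yes same = cong₂ _+_ (trans (both-vanish G-insertion γ) (sym (both-vanish N-insertion (toC γ))))
                                 (onePlusQℕ-cong (chiTerm-merge D u v κ same γ) k)
        where
        both-vanish : ∀ {H′ H} (I : EdgeInsertion H′ H (endpoints G e)) γ →
                      chiTerm H′ (EdgeInsertion.insert I γ true) κ k
                      + chiTerm H′ (EdgeInsertion.insert I γ false) κ k ≡ 0
        both-vanish I γ = cong₂ _+_ (chiTerm-insert-monochromatic I κ same γ true k)
                                    (chiTerm-insert-monochromatic I κ same γ false k)

      balanced-per-orientation : ∀ γ →
        Balanced (λ k → χ G (toG γ true) k + χ G (toG γ false) k) (χ C (toC γ))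
                 (λ k → χ N (toN γ true) k + χ N (toN γ false) k) (χ D γ)
      balanced-per-orientation γ =
        Balanced-cong (chi-pair G toG) (λ k → sym (chiCoeff-sum C (toC γ) k))
                      (chi-pair N toN) (λ k → sym (chiCoeff-sum D γ k))
                      (Balanced-sum colourings (balanced-per-colouring γ))
        where
        chi-pair : (H : Graph n) (to : Orientation D → Bool → Orientation H) → ∀ k →
                   sumOver colourings (λ κ → chiTerm H (to γ true) κ k + chiTerm H (to γ false) κ k)
                   ≡ χ H (to γ true) k + χ H (to γ false) k
        chi-pair H to k = trans (sumOver-+ colourings _ _)
                                (sym (cong₂ _+_ (chiCoeff-sum H (to γ true) k) (chiCoeff-sum H (to γ false) k)))

      acyclicD : Orientation D → ℕ
      acyclicD γ = indicator (does (acyc? D γ))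

      sumOrientations-toC : (F : Orientation C → ℕ) →
                            sumOrientations (length (edges C)) (λ γC → indicator (does (acyc? C γC)) * F γC)
                            ≡ sumOrientations (length (edges D)) (λ γ → acyclicD γ * F (toC γ))
      sumOrientations-toC F =
        trans (sumOrientations-relabel (rename u v) (edges D) _)
              (sumOver-cong (orientations (length (edges D)))
                            (λ γ → cong (λ b → indicator b * F (toC γ)) (acyclic-C γ)))

      TchiCoeffℕ-G : ∀ k → TchiCoeffℕ acyc? G m α k
                           ≡ sumOrientations (length (edges D))
                                             (λ γ → acyclicD γ * (χ G (toG γ true) k + χ G (toG γ false) k))
      TchiCoeffℕ-G k =
        trans (TchiCoeffℕ-sumOrientations acyc? G m α k)
              (sum-insert-weighted G-insertion (λ γ′ → does (acyc? G γ′)) (λ γ → does (acyc? D γ))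
                                   acyclic-G (λ γ′ → χ G γ′ k))

      TchiCoeffℕ-C : ∀ k → TchiCoeffℕ acyc? C m α k
                           ≡ sumOrientations (length (edges D)) (λ γ → acyclicD γ * χ C (toC γ) k)
      TchiCoeffℕ-C k =
        trans (TchiCoeffℕ-sumOrientations acyc? C m α k) (sumOrientations-toC (λ γC → χ C γC k))

      TchiCoeffℕ-N : ∀ k → TchiCoeffℕ acyc? N m α k
                           ≡ sumOrientations (length (edges D))
                                             (λ γ → acyclicD γ * (χ N (toN γ true) k + χ N (toN γ false) k))
      TchiCoeffℕ-N k =
        trans (TchiCoeffℕ-sumOrientations acyc? N m α k)
              (trans (sum-insert-weighted N-insertion (λ γ′ → does (acyc? N γ′))
                                          (λ γC → does (acyc? C γC)) acyclic-N (λ γ′ → χ N γ′ k))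
                     (sumOrientations-toC _))

    TchiCoeffℕ-balanced : Balanced (TchiCoeffℕ acyc? G m α)
                                   (TchiCoeffℕ acyc? (nearContractDel G e) m α)
                                   (TchiCoeffℕ acyc? (nearContract G e) m α)
                                   (TchiCoeffℕ acyc? (deleteEdge G e) m α)
    TchiCoeffℕ-balanced =
      Balanced-cong (λ k → sym (TchiCoeffℕ-G k)) (λ k → sym (TchiCoeffℕ-C k))
                    (λ k → sym (TchiCoeffℕ-N k)) (λ k → sym (TchiCoeffℕ-sumOrientations acyc? D m α k))
                    (Balanced-sum (orientations (length (edges D)))
                                  (λ γ → Balanced-scale (acyclicD γ) (balanced-per-orientation γ)))

open import Data.Integer using (+_; _+_; _-_)
open import Data.Integer.Properties using (pos-+)
open import Data.Integer.Tactic.RingSolver using (solve-∀)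

onePlusQ-difference : (d c : ℕ → ℕ) → ∀ k →
                      onePlusQ (λ j → + d j - + c j) k ≡ + onePlusQℕ d k - + onePlusQℕ c k
onePlusQ-difference d c zero
  rewrite +-identityʳ (d zero) | +-identityʳ (c zero) = refl
onePlusQ-difference d c (suc k)
  rewrite pos-+ (d (suc k)) (d k) | pos-+ (c (suc k)) (c k) =
  regroup (+ d (suc k)) (+ c (suc k)) (+ d k) (+ c k)
  where
  regroup : ∀ a b x y → (a - b) + (x - y) ≡ (a + x) - (b + y)
  regroup = solve-∀

Balanced⇒onePlusQ : {g c n d : ℕ → ℕ} → Balanced g c n d →
                    ∀ k → + g k ≡ + n k + onePlusQ (λ j → + d j - + c j) k
Balanced⇒onePlusQ {g} {c} {n} {d} bal k = begin
  + g k                  ≡⟨ cancel (+ g k) (+ c′) ⟩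
  (+ g k + + c′) - + c′  ≡⟨ cong (_- + c′) (sym (pos-+ (g k) c′)) ⟩
  + (g k ℕ.+ c′) - + c′  ≡⟨ cong (λ x → + x - + c′) (bal k) ⟩
  + (n k ℕ.+ d′) - + c′  ≡⟨ cong (_- + c′) (pos-+ (n k) d′) ⟩
  (+ n k + + d′) - + c′  ≡⟨ reassoc (+ n k) (+ d′) (+ c′) ⟩
  + n k + (+ d′ - + c′)  ≡⟨ cong (λ x → + n k + x) (sym (onePlusQ-difference d c k)) ⟩
  + n k + onePlusQ (λ j → + d j - + c j) k ∎
  where
  open ≡-Reasoning
  c′ = onePlusQℕ c k
  d′ = onePlusQℕ d k
  cancel : ∀ a b → a ≡ (a + b) - b
  cancel = solve-∀
  reassoc : ∀ a b c → (a + b) - c ≡ a + (b - c)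
  reassoc = solve-∀

-- The identity holds for every bridge of a simple graph.
theorem3p12 : (acyc? : AcyclicDecider) → (n : ℕ) → (G : Graph n) → IsSimple G →
    (e : Edge G) → Internal G e → InNoCycle G e →
    (m : ℕ) → (α : Vec ℕ m) → (k : ℕ) →
    TchiCoeff acyc? G m α k
      ≡ TchiCoeff acyc? (nearContract G e) m α k
        + onePlusQ (λ j → TchiCoeff acyc? (deleteEdge G e) m α j
                          - TchiCoeff acyc? (nearContractDel G e) m α j) k
theorem3p12 acyc? n G simple e _ no-cycle m α =
  Balanced⇒onePlusQ (TchiCoeffℕ-balanced acyc? G e simple no-cycle m α)
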